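{- Let $P$ be a weakly graded $(\mathbf{3+1})$-avoiding poset of height $k+1$ with $k\ge1$. Then every maximal element of $P$ has rank $k$ or $k-1$, and every minimal element of $P$ has rank $0$ or $1$.
   Context: All posets are finite. A poset $P$ is weakly graded if there is a function $\operatorname{rk}:P\to\mathbb{N}$ such that $\operatorname{rk}(b)=\operatorname{rk}(a)+1$ whenever $b$ covers $a$, and such that the minimum value of $\operatorname{rk}$ on each connected component is $0$. The height is the number of elements of a longest chain. A poset is $(\mathbf{3+1})$-avoiding if there are no four elements $x,y,z,w$ with $x<y<z$ and $w$ incomparable to each of $x,y,z$. -}

module Defs where

open import Data.Nat using (ℕ; suc; _+_; _≤_)
open import Data.Fin using (Fin)
open import Data.Product using (_×_; Σ; ∃; ∃-syntax; _,_)
open import Data.Sum using (_⊎_)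
open import Data.List using (List; length)
open import Data.List.Relation.Unary.Linked using (Linked)
open import Relation.Nullary using (¬_)
open import Relation.Binary using (Rel; IsPartialOrder)
open import Relation.Binary.PropositionalEquality using (_≡_)
open import Relation.Binary.Construct.Closure.ReflexiveTransitive using (Star)

record FinPoset : Set₁ where
  field
    size    : ℕ
    _≼_     : Rel (Fin size) _
    isPO    : IsPartialOrder _≡_ _≼_

module _ (P : FinPoset) where
  open FinPoset P

  _≺_ : Rel (Fin size) _
  a ≺ b = a ≼ b × ¬ (a ≡ b)

  Covers : Fin size → Fin size → Set
  Covers b a = a ≺ b × (∀ c → ¬ (a ≺ c × c ≺ b))

  Comparable : Rel (Fin size) _
  Comparable a b = a ≼ b ⊎ b ≼ a

  Incomparable : Rel (Fin size) _
  Incomparable a b = ¬ Comparable a b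

  SameComponent : Rel (Fin size) _
  SameComponent = Star Comparable

  IsWeakRank : (Fin size → ℕ) → Set
  IsWeakRank rk =
    (∀ a b → Covers b a → rk b ≡ rk a + 1)
    × (∀ x → ∃[ y ] (SameComponent x y × rk y ≡ 0))

  WeaklyGraded : Set
  WeaklyGraded = ∃[ rk ] IsWeakRank rk

  IsChain : List (Fin size) → Set
  IsChain = Linked _≺_

  HasHeight : ℕ → Set
  HasHeight h = (∃[ c ] (IsChain c × length c ≡ h))
              × (∀ c → IsChain c → length c ≤ h)

  Avoids3+1 : Set
  Avoids3+1 = ∀ x y z w → x ≺ y → y ≺ z →
    ¬ (Incomparable w x × Incomparable w y × Incomparable w z)

  IsMaximal : Fin size → Set
  IsMaximal x = ∀ y → x ≼ y → y ≡ x

  IsMinimal : Fin size → Set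
  IsMinimal x = ∀ y → y ≼ x → y ≡ x

-- Refining a chain until it is saturated shows that along any chain of n steps from a to b
-- the rank grows by at least n and by at most k, the number of steps of a longest chain.
-- Let c₀ ≺ c₁ ≺ ⋯ ≺ cₖ be a longest chain. By (3+1)-avoidance a minimal element x is
-- comparable to, hence below or equal to, one of c₀, c₁, c₂, so x starts a chain to cₖ of at
-- least k − 1 steps, which forces rk c₀ ≤ rk x ≤ rk c₀ + 1. An element of rank 0 is minimal,
-- so rk c₀ = 0. Dually a maximal element lies above c_{k−2}, c_{k−1} or cₖ and is reached
-- from c₀ by at least k − 1 steps. For k = 1 there is no chain of two steps, so every strict
-- relation is a cover, and walking along comparabilities from an element of rank 0 keeps
-- every rank at most 1.
module Submission where

open import Defs hiding (_≺_)
import Defs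
open import Data.Nat using (ℕ; zero; suc; _+_; _≤_; _<_; _≤?_; z≤n; s≤s; s≤s⁻¹)
open import Data.Nat.Properties
  using (≤-refl; ≤-trans; ≤-antisym; ≤⇒≯; n≤1+n; m≤m+n; +-identityʳ; +-suc; +-comm; +-assoc;
         +-monoʳ-≤; +-cancelʳ-≤; +-cancelʳ-≡; n≤0⇒n≡0; m≤n⇒m<n∨m≡n; m+1+n≢0; module ≤-Reasoning)
open import Data.Fin using (Fin) renaming (_≟_ to _≟ᶠ_)
open import Data.Product using (_×_; Σ-syntax; ∃-syntax; _,_; proj₁; proj₂)
open import Data.Sum using (_⊎_; inj₁; inj₂)
open import Data.Empty using (⊥; ⊥-elim)
open import Data.List using (List; []; _∷_; length)
open import Data.List.Relation.Unary.Linked using ([-]; _∷_)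
open import Level using (0ℓ)
open import Effect.Monad using (RawMonad)
open import Relation.Nullary using (¬_; yes; no)
open import Relation.Nullary.Decidable using (decidable-stable; ¬¬-excluded-middle; _×-dec_)
open import Relation.Nullary.Negation using (¬¬-Monad; ¬¬-map)
open import Relation.Binary using (IsPartialOrder)
open import Relation.Binary.PropositionalEquality using (_≡_; refl; sym; trans; cong; subst; module ≡-Reasoning)
open import Relation.Binary.Construct.Closure.ReflexiveTransitive using (ε; _◅_)

open RawMonad (¬¬-Monad {0ℓ}) using (pure; _>>=_)

m≤1⇒m≡0⊎m≡1 : ∀ {m} → m ≤ 1 → m ≡ 0 ⊎ m ≡ 1
m≤1⇒m≡0⊎m≡1 z≤n = inj₁ refl
m≤1⇒m≡0⊎m≡1 (s≤s z≤n) = inj₂ refl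

n≤m≤1+n⇒m≡1+n⊎m+1≡1+n : ∀ {m n} → n ≤ m → m ≤ suc n → m ≡ suc n ⊎ m + 1 ≡ suc n
n≤m≤1+n⇒m≡1+n⊎m+1≡1+n {m} n≤m m≤1+n with m≤n⇒m<n∨m≡n m≤1+n
... | inj₁ m<1+n = inj₂ (trans (+-comm m 1) (cong suc (≤-antisym (s≤s⁻¹ m<1+n) n≤m)))
... | inj₂ m≡1+n = inj₁ m≡1+n

module _ (P : FinPoset) where
  open FinPoset P
  open IsPartialOrder isPO using (reflexive)

  _≺_ : Fin size → Fin size → Set
  _≺_ = Defs._≺_ P

  ≼⇒≡⊎≺ : ∀ {a b} → a ≼ b → a ≡ b ⊎ a ≺ b
  ≼⇒≡⊎≺ {a} {b} a≼b with a ≟ᶠ b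
  ... | yes a≡b = inj₁ a≡b
  ... | no a≢b = inj₂ (a≼b , a≢b)

  minimal-comparable⇒≼ : ∀ {x y} → IsMinimal P x → Comparable P x y → x ≼ y
  minimal-comparable⇒≼ min (inj₁ x≼y) = x≼y
  minimal-comparable⇒≼ min (inj₂ y≼x) = reflexive (sym (min _ y≼x))

  maximal-comparable⇒≽ : ∀ {x y} → IsMaximal P x → Comparable P x y → y ≼ x
  maximal-comparable⇒≽ max (inj₁ x≼y) = reflexive (max _ x≼y)
  maximal-comparable⇒≽ max (inj₂ y≼x) = y≼x

  minimal⇒¬≻ : ∀ {x y} → IsMinimal P x → ¬ (y ≺ x)
  minimal⇒¬≻ min (y≼x , y≢x) = y≢x (min _ y≼x)

  maximal⇒¬≺ : ∀ {x y} → IsMaximal P x → ¬ (x ≺ y)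
  maximal⇒¬≺ max (x≼y , x≢y) = x≢y (sym (max _ x≼y))

  -- Chain a b n: a chain from a to b with n strict steps, hence n + 1 elements.
  data Chain : Fin size → Fin size → ℕ → Set where
    [] : ∀ {a} → Chain a a 0
    _∷_ : ∀ {a b c n} → a ≺ b → Chain b c n → Chain a c (suc n)

  successors : ∀ {a b n} → Chain a b n → List (Fin size)
  successors [] = []
  successors (_∷_ {b = b} _ C) = b ∷ successors C

  toList : ∀ {a b n} → Chain a b n → List (Fin size)
  toList {a} C = a ∷ successors C

  toList-isChain : ∀ {a b n} (C : Chain a b n) → IsChain P (toList C)
  toList-isChain [] = [-]
  toList-isChain (a≺b ∷ C) = a≺b ∷ toList-isChain C

  length-toList : ∀ {a b n} (C : Chain a b n) → length (toList C) ≡ suc n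
  length-toList [] = refl
  length-toList (_ ∷ C) = cong suc (length-toList C)

  fromIsChain : ∀ x xs → IsChain P (x ∷ xs) → ∃[ b ] Chain x b (length xs)
  fromIsChain x [] _ = x , []
  fromIsChain x (y ∷ xs) (x≺y ∷ linked) with fromIsChain y xs linked
  ... | b , C = b , x≺y ∷ C

  _∷ʳ_ : ∀ {a b c n} → Chain a b n → b ≺ c → Chain a c (suc n)
  [] ∷ʳ b≺c = b≺c ∷ []
  (a≺a′ ∷ C) ∷ʳ b≺c = a≺a′ ∷ (C ∷ʳ b≺c)

  unsnoc : ∀ {a c n} → Chain a c (suc n) → ∃[ b ] (Chain a b n × b ≺ c)
  unsnoc (a≺c ∷ []) = _ , [] , a≺c
  unsnoc (a≺a′ ∷ C@(_ ∷ _)) with unsnoc C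
  ... | b , D , b≺c = b , a≺a′ ∷ D , b≺c

  ChainsBoundedBy : ℕ → Set
  ChainsBoundedBy h = ∀ c → IsChain P c → length c ≤ h

  steps≤ : ∀ {k a b n} → ChainsBoundedBy (suc k) → Chain a b n → n ≤ k
  steps≤ {k} bounded C = s≤s⁻¹ (subst (_≤ suc k) (length-toList C) (bounded _ (toList-isChain C)))

  longestChain : ∀ {k} → (∃[ c ] (IsChain P c × length c ≡ suc k)) → ∃[ a ] ∃[ b ] Chain a b k
  longestChain ([] , _ , ())
  longestChain (x ∷ xs , linked , refl) with fromIsChain x xs linked
  ... | b , C = x , b , C

  Refinable : ∀ {a b n} → Chain a b n → Set
  Refinable [] = ⊥
  Refinable (_∷_ {a} {b} _ C) = (∃[ d ] (a ≺ d × d ≺ b)) ⊎ Refinable C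

  Saturated : ∀ {a b n} → Chain a b n → Set
  Saturated C = ¬ Refinable C

  refine : ∀ {a b n} (C : Chain a b n) → Refinable C → Chain a b (suc n)
  refine (_ ∷ C) (inj₁ (d , a≺d , d≺b)) = a≺d ∷ (d≺b ∷ C)
  refine (a≺b ∷ C) (inj₂ r) = a≺b ∷ refine C r

  comparable-to-one-of : ∀ {x y z} w → Avoids3+1 P → x ≺ y → y ≺ z →
    ¬ ¬ (Comparable P w x ⊎ Comparable P w y ⊎ Comparable P w z)
  comparable-to-one-of w avoids x≺y y≺z none =
    avoids _ _ _ w x≺y y≺z
      ((λ c → none (inj₁ c)) , (λ c → none (inj₂ (inj₁ c))) , (λ c → none (inj₂ (inj₂ c))))

  minimal-starts-long-chain : ∀ {c d n x} → Avoids3+1 P → Chain c d (suc (suc n)) →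
    IsMinimal P x → ¬ ¬ (∃[ m ] (suc n ≤ m × Chain x d m))
  minimal-starts-long-chain {n = n} {x} avoids C@(c₀≺c₁ ∷ R₁@(c₁≺c₂ ∷ R₂)) min =
    ¬¬-map below (comparable-to-one-of x avoids c₀≺c₁ c₁≺c₂)
    where
      below : _ → ∃[ m ] (suc n ≤ m × Chain x _ m)
      below (inj₁ c) with ≼⇒≡⊎≺ (minimal-comparable⇒≼ min c)
      ... | inj₁ refl = _ , n≤1+n _ , C
      ... | inj₂ x≺c₀ = _ , ≤-trans (n≤1+n _) (n≤1+n _) , x≺c₀ ∷ C
      below (inj₂ (inj₁ c)) with ≼⇒≡⊎≺ (minimal-comparable⇒≼ min c)
      ... | inj₁ refl = ⊥-elim (minimal⇒¬≻ min c₀≺c₁)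
      ... | inj₂ x≺c₁ = _ , n≤1+n _ , x≺c₁ ∷ R₁
      below (inj₂ (inj₂ c)) with ≼⇒≡⊎≺ (minimal-comparable⇒≼ min c)
      ... | inj₁ refl = ⊥-elim (minimal⇒¬≻ min c₁≺c₂)
      ... | inj₂ x≺c₂ = _ , ≤-refl , x≺c₂ ∷ R₂

  maximal-ends-long-chain : ∀ {c d n x} → Avoids3+1 P → Chain c d (suc (suc n)) →
    IsMaximal P x → ¬ ¬ (∃[ m ] (suc n ≤ m × Chain c x m))
  maximal-ends-long-chain {n = n} {x} avoids C max with unsnoc C
  ... | b , Cb , b≺d with unsnoc Cb
  ... | a , Ca , a≺b = ¬¬-map above (comparable-to-one-of x avoids a≺b b≺d)
    where
      above : _ → ∃[ m ] (suc n ≤ m × Chain _ x m)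
      above (inj₁ c) with ≼⇒≡⊎≺ (maximal-comparable⇒≽ max c)
      ... | inj₁ refl = ⊥-elim (maximal⇒¬≺ max a≺b)
      ... | inj₂ a≺x = _ , ≤-refl , Ca ∷ʳ a≺x
      above (inj₂ (inj₁ c)) with ≼⇒≡⊎≺ (maximal-comparable⇒≽ max c)
      ... | inj₁ refl = ⊥-elim (maximal⇒¬≺ max b≺d)
      ... | inj₂ b≺x = _ , n≤1+n _ , Cb ∷ʳ b≺x
      above (inj₂ (inj₂ c)) with ≼⇒≡⊎≺ (maximal-comparable⇒≽ max c)
      ... | inj₁ refl = _ , n≤1+n _ , C
      ... | inj₂ d≺x = _ , ≤-trans (n≤1+n _) (n≤1+n _) , C ∷ʳ d≺x

  module Graded (rk : Fin size → ℕ) (rk-covers : ∀ a b → Covers P b a → rk b ≡ rk a + 1)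
                (k : ℕ) (bounded : ChainsBoundedBy (suc k)) where

    saturated-rank : ∀ {a b n} (C : Chain a b n) → Saturated C → rk b ≡ rk a + n
    saturated-rank {a} [] _ = sym (+-identityʳ (rk a))
    saturated-rank {a} {b} (_∷_ {b = a′} {n = n} a≺a′ C) saturated = begin
      rk b          ≡⟨ saturated-rank C (λ r → saturated (inj₂ r)) ⟩
      rk a′ + n     ≡⟨ cong (_+ n) (rk-covers a a′ a′-covers-a) ⟩
      rk a + 1 + n  ≡⟨ +-assoc (rk a) 1 n ⟩
      rk a + suc n  ∎
      where
        open ≡-Reasoning
        a′-covers-a : Covers P a′ a
        a′-covers-a = a≺a′ , λ d between → saturated (inj₁ (d , between))

    -- The order is not assumed decidable, so a chain can be saturated only up to double
    -- negation; ℕ-valued consequences are recovered with decidable-stable. The fuel bounds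
    -- the number of refinements, since no chain has more than k steps.
    saturate-within : ∀ {a b n} fuel → k < fuel + n → (C : Chain a b n) →
      ¬ ¬ (∃[ m ] (n ≤ m × Σ[ D ∈ Chain a b m ] Saturated D))
    saturate-within zero k<n C = ⊥-elim (≤⇒≯ (steps≤ bounded C) k<n)
    saturate-within {n = n} (suc fuel) k<n C = do
      yes r ← ¬¬-excluded-middle
        where no saturated → pure (n , ≤-refl , C , saturated)
      (m , 1+n≤m , D , saturated) ←
        saturate-within fuel (subst (k <_) (sym (+-suc fuel n)) k<n) (refine C r)
      pure (m , ≤-trans (n≤1+n n) 1+n≤m , D , saturated)

    rank-bounds : ∀ {a b n} → Chain a b n → rk a + n ≤ rk b × rk b ≤ rk a + k
    rank-bounds {a} {b} {n} C =
      decidable-stable (rk a + n ≤? rk b ×-dec rk b ≤? rk a + k)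
        (¬¬-map bounds (saturate-within (suc k) (s≤s (m≤m+n k n)) C))
      where
        bounds : ∃[ m ] (n ≤ m × Σ[ D ∈ Chain a b m ] Saturated D) →
          rk a + n ≤ rk b × rk b ≤ rk a + k
        bounds (m , n≤m , D , saturated) rewrite saturated-rank D saturated =
          +-monoʳ-≤ (rk a) n≤m , +-monoʳ-≤ (rk a) (steps≤ bounded D)

    rank-zero⇒minimal : ∀ {z} → rk z ≡ 0 → IsMinimal P z
    rank-zero⇒minimal {z} rz≡0 y y≼z with ≼⇒≡⊎≺ y≼z
    ... | inj₁ y≡z = y≡z
    ... | inj₂ y≺z =
      ⊥-elim (m+1+n≢0 (rk y) (n≤0⇒n≡0 (subst (rk y + 1 ≤_) rz≡0 (proj₁ (rank-bounds (y≺z ∷ []))))))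

  module HeightTwo (rk : Fin size → ℕ) (weak-rank : IsWeakRank P rk) (bounded : ChainsBoundedBy 2) where

    no-two-steps : ∀ {a b c} → a ≺ b → b ≺ c → ⊥
    no-two-steps a≺b b≺c with steps≤ bounded (a≺b ∷ (b≺c ∷ []))
    ... | s≤s ()

    ≺⇒rank+1 : ∀ {a b} → a ≺ b → rk b ≡ rk a + 1
    ≺⇒rank+1 {a} {b} a≺b = proj₁ weak-rank a b (a≺b , λ c (a≺c , c≺b) → no-two-steps a≺c c≺b)

    RankZeroOrAboveRankZero : Fin size → Set
    RankZeroOrAboveRankZero w = rk w ≡ 0 ⊎ ∃[ u ] (u ≺ w × rk u ≡ 0)

    comparable-preserves : ∀ {x y} → Comparable P x y →
      RankZeroOrAboveRankZero y → RankZeroOrAboveRankZero x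
    comparable-preserves (inj₁ x≼y) inv with ≼⇒≡⊎≺ x≼y
    ... | inj₁ refl = inv
    ... | inj₂ x≺y with inv
    ...   | inj₁ ry≡0 = ⊥-elim (m+1+n≢0 _ (trans (sym (≺⇒rank+1 x≺y)) ry≡0))
    ...   | inj₂ (u , u≺y , ru≡0) =
      inj₁ (+-cancelʳ-≡ 1 _ 0 (trans (sym (≺⇒rank+1 x≺y)) (trans (≺⇒rank+1 u≺y) (cong (_+ 1) ru≡0))))
    comparable-preserves (inj₂ y≼x) inv with ≼⇒≡⊎≺ y≼x
    ... | inj₁ refl = inv
    ... | inj₂ y≺x with inv
    ...   | inj₁ ry≡0 = inj₂ (_ , y≺x , ry≡0)
    ...   | inj₂ (u , u≺y , _) = ⊥-elim (no-two-steps u≺y y≺x)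

    connected-preserves : ∀ {x y} → SameComponent P x y →
      RankZeroOrAboveRankZero y → RankZeroOrAboveRankZero x
    connected-preserves ε inv = inv
    connected-preserves (c ◅ path) inv = comparable-preserves c (connected-preserves path inv)

    rank≤1 : ∀ x → rk x ≤ 1
    rank≤1 x with proj₂ weak-rank x
    ... | y , path , ry≡0 with connected-preserves path (inj₁ ry≡0)
    ...   | inj₁ rx≡0 = subst (_≤ 1) (sym rx≡0) z≤n
    ...   | inj₂ (u , u≺x , ru≡0) = subst (_≤ 1) (sym (trans (≺⇒rank+1 u≺x) (cong (_+ 1) ru≡0))) ≤-refl

module LongestChain (P : FinPoset) (rk : Fin (FinPoset.size P) → ℕ) (weak-rank : IsWeakRank P rk)
  (avoids : Avoids3+1 P) (n : ℕ) (bounded : ChainsBoundedBy P (suc (suc (suc n))))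
  {c d : Fin (FinPoset.size P)} (C : Chain P c d (suc (suc n))) where
  open Graded P rk (proj₁ weak-rank) (suc (suc n)) bounded

  minimal-near-bottom : ∀ {x} → IsMinimal P x → rk c ≤ rk x × rk x ≤ suc (rk c)
  minimal-near-bottom {x} min =
    decidable-stable (rk c ≤? rk x ×-dec rk x ≤? suc (rk c))
      (¬¬-map bounds (minimal-starts-long-chain P avoids C min))
    where
      bounds : ∃[ m ] (suc n ≤ m × Chain P x d m) → rk c ≤ rk x × rk x ≤ suc (rk c)
      bounds (m , 1+n≤m , D) with rank-bounds C | rank-bounds D
      ... | C-lower , C-upper | D-lower , D-upper =
        +-cancelʳ-≤ (suc (suc n)) (rk c) (rk x) (≤-trans C-lower D-upper) ,
        +-cancelʳ-≤ (suc n) (rk x) (suc (rk c)) (begin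
          rk x + suc n        ≤⟨ +-monoʳ-≤ (rk x) 1+n≤m ⟩
          rk x + m            ≤⟨ D-lower ⟩
          rk d                ≤⟨ C-upper ⟩
          rk c + suc (suc n)  ≡⟨ +-suc (rk c) (suc n) ⟩
          suc (rk c) + suc n  ∎)
        where open ≤-Reasoning

  -- z need not be comparable to C: (3+1)-avoidance alone ties every minimal element to c.
  bottom-rank≡0 : rk c ≡ 0
  bottom-rank≡0 with proj₂ weak-rank c
  ... | z , _ , rz≡0 =
    n≤0⇒n≡0 (subst (rk c ≤_) rz≡0 (proj₁ (minimal-near-bottom (rank-zero⇒minimal rz≡0))))

  minimal-rank : ∀ x → IsMinimal P x → rk x ≡ 0 ⊎ rk x ≡ 1
  minimal-rank x min =
    m≤1⇒m≡0⊎m≡1 (subst (λ r → rk x ≤ suc r) bottom-rank≡0 (proj₂ (minimal-near-bottom min)))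

  maximal-near-top : ∀ {x} → IsMaximal P x → suc n ≤ rk x × rk x ≤ suc (suc n)
  maximal-near-top {x} max =
    decidable-stable (suc n ≤? rk x ×-dec rk x ≤? suc (suc n))
      (¬¬-map bounds (maximal-ends-long-chain P avoids C max))
    where
      bounds : ∃[ m ] (suc n ≤ m × Chain P c x m) → suc n ≤ rk x × rk x ≤ suc (suc n)
      bounds (m , 1+n≤m , D) with rk c | bottom-rank≡0 | rank-bounds D
      ... | .0 | refl | lower , upper = ≤-trans 1+n≤m lower , upper

  maximal-rank : ∀ x → IsMaximal P x → rk x ≡ suc (suc n) ⊎ rk x + 1 ≡ suc (suc n)
  maximal-rank x max with maximal-near-top max
  ... | lower , upper = n≤m≤1+n⇒m≡1+n⊎m+1≡1+n lower upper

proposition8p1 : (P : FinPoset) (k : ℕ) → 1 ≤ k →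
    (rk : Fin (FinPoset.size P) → ℕ) → IsWeakRank P rk →
    Avoids3+1 P → HasHeight P (suc k) →
    (∀ x → IsMaximal P x → rk x ≡ k ⊎ rk x + 1 ≡ k)
    × (∀ x → IsMinimal P x → rk x ≡ 0 ⊎ rk x ≡ 1)
proposition8p1 P (suc zero) _ rk weak-rank _ (_ , bounded) =
  (λ x _ → n≤m≤1+n⇒m≡1+n⊎m+1≡1+n z≤n (rank≤1 x)) , (λ x _ → m≤1⇒m≡0⊎m≡1 (rank≤1 x))
  where open HeightTwo P rk weak-rank bounded
proposition8p1 P (suc (suc n)) _ rk weak-rank avoids (longest , bounded)
  with longestChain P longest
... | c , d , C = maximal-rank , minimal-rank
  where open LongestChain P rk weak-rank avoids n bounded C
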